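{- The class of weak betweenness algebras is not closed under (direct) products.
   Context: $A$ is a non-trivial Boolean algebra ($+,\cdot,-,0,1$). A PS-algebra $\langle A,f,g\rangle$ has $f:A^2\to A$ with $f(0,y)=f(x,0)=0$ and additive in each argument, and $g:A^2\to A$ with $g(0,y)=g(x,0)=1$, $g(x+x',y)=g(x,y)\cdot g(x',y)$ and $g(x,y+y')=g(x,y)\cdot g(x,y')$. A weak betweenness algebra is a PS-algebra satisfying for all $x,y,z$: $x\le f(x,x)$; $f(x,y)\le f(y,x)$; $g(x,y)\le g(y,x)$; $y\cdot f(x,z)\le f(x\cdot f(x,y),z)$; and $x\neq 0\to g(x,x)\le x$. Products are taken coordinatewise in the signature $(+,\cdot,-,0,1,f,g)$. -}

module Defs where

open import Level using (Level; _⊔_; suc)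
open import Data.Product using (_×_; _,_; proj₁; proj₂)
open import Relation.Nullary using (¬_)
open import Relation.Binary.Core using (Rel)
open import Algebra.Lattice.Structures using (IsBooleanAlgebra)

record Sig (c ℓ : Level) : Set (suc (c ⊔ ℓ)) where
  infix  4 _≈_ _≤_
  infixl 6 _+_
  infixl 7 _·_
  field
    Carrier : Set c
    _≈_     : Rel Carrier ℓ
    _+_     : Carrier → Carrier → Carrier
    _·_     : Carrier → Carrier → Carrier
    -_      : Carrier → Carrier
    0#      : Carrier
    1#      : Carrier
    f       : Carrier → Carrier → Carrier
    g       : Carrier → Carrier → Carrier

  _≤_ : Carrier → Carrier → Set ℓ
  x ≤ y = (x · y) ≈ x

record IsPSAlgebra {c ℓ} (A : Sig c ℓ) : Set (c ⊔ ℓ) where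
  open Sig A
  field
    isBooleanAlgebra : IsBooleanAlgebra _≈_ _+_ _·_ -_ 1# 0#
    nontrivial       : ¬ (0# ≈ 1#)
    f-0ˡ : ∀ y → f 0# y ≈ 0#
    f-0ʳ : ∀ x → f x 0# ≈ 0#
    f-+ˡ : ∀ x x' y → f (x + x') y ≈ f x y + f x' y
    f-+ʳ : ∀ x y y' → f x (y + y') ≈ f x y + f x y'
    g-0ˡ : ∀ y → g 0# y ≈ 1#
    g-0ʳ : ∀ x → g x 0# ≈ 1#
    g-+ˡ : ∀ x x' y → g (x + x') y ≈ g x y · g x' y
    g-+ʳ : ∀ x y y' → g x (y + y') ≈ g x y · g x y'

record IsWeakBetweennessAlgebra {c ℓ} (A : Sig c ℓ) : Set (c ⊔ ℓ) where
  open Sig A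
  field
    isPSAlgebra : IsPSAlgebra A
    ax1 : ∀ x → x ≤ f x x
    ax2 : ∀ x y → f x y ≤ f y x
    ax3 : ∀ x y → g x y ≤ g y x
    ax4 : ∀ x y z → y · f x z ≤ f (x · f x y) z
    ax5 : ∀ x → ¬ (x ≈ 0#) → g x x ≤ x

_⊗_ : ∀ {a b ℓ₁ ℓ₂} → Sig a ℓ₁ → Sig b ℓ₂ → Sig (a ⊔ b) (ℓ₁ ⊔ ℓ₂)
A ⊗ B = record
  { Carrier = A.Carrier × B.Carrier
  ; _≈_ = λ p q → (proj₁ p A.≈ proj₁ q) × (proj₂ p B.≈ proj₂ q)
  ; _+_ = λ p q → (proj₁ p A.+ proj₁ q , proj₂ p B.+ proj₂ q)
  ; _·_ = λ p q → (proj₁ p A.· proj₁ q , proj₂ p B.· proj₂ q)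
  ; -_  = λ p → (A.- proj₁ p , B.- proj₂ p)
  ; 0#  = (A.0# , B.0#)
  ; 1#  = (A.1# , B.1#)
  ; f   = λ p q → (A.f (proj₁ p) (proj₁ q) , B.f (proj₂ p) (proj₂ q))
  ; g   = λ p q → (A.g (proj₁ p) (proj₁ q) , B.g (proj₂ p) (proj₂ q))
  }
  where
    module A = Sig A
    module B = Sig B

{-# OPTIONS --safe #-}
-- The axiom x ≠ 0 → g(x,x) ≤ x is not equational, and it fails in every
-- product: for x = (1,0) we have x ≠ 0, while the second coordinate of
-- g(x,x) is g(0,0) = 1, which is not below 0. So no product of two
-- PS-algebras is a weak betweenness algebra, and it suffices to exhibit one
-- weak betweenness algebra: the two-element one with f = · and g = 1.
module Submission where

open import Defs
open import Level using (0ℓ)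
open import Data.Product using (Σ; _×_; _,_; proj₂)
open import Relation.Nullary using (¬_)
open import Data.Empty using (⊥-elim)
open import Data.Bool using (Bool; true; false; _∨_; _∧_; not)
import Data.Bool.Properties as Bool
open import Relation.Binary.PropositionalEquality using (_≡_; refl)
open import Algebra.Lattice.Bundles using (BooleanAlgebra)
import Algebra.Lattice.Properties.BooleanAlgebra as BooleanAlgebraProperties

module _ {c ℓ} {A : Sig c ℓ} (isPS : IsPSAlgebra A) where
  open Sig A
  open IsPSAlgebra isPS

  booleanAlgebra : BooleanAlgebra c ℓ
  booleanAlgebra = record { isBooleanAlgebra = isBooleanAlgebra }

  open BooleanAlgebra booleanAlgebra using (setoid)
  open BooleanAlgebraProperties booleanAlgebra using (∧-zeroʳ)
  open import Relation.Binary.Reasoning.Setoid setoid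

  g00≰0 : ¬ (g 0# 0# ≤ 0#)
  g00≰0 g00≤0 = nontrivial (begin
    0#            ≈⟨ ∧-zeroʳ (g 0# 0#) ⟨
    g 0# 0# · 0#  ≈⟨ g00≤0 ⟩
    g 0# 0#       ≈⟨ g-0ˡ 0# ⟩
    1#            ∎)

¬isWeakBetweenness-⊗ : ∀ {a b ℓ₁ ℓ₂} {A : Sig a ℓ₁} {B : Sig b ℓ₂} →
  IsPSAlgebra A → IsPSAlgebra B → ¬ IsWeakBetweennessAlgebra (A ⊗ B)
¬isWeakBetweenness-⊗ {A = A} {B} isPS-A isPS-B isWB =
  g00≰0 isPS-B (proj₂ (ax5 (1# A , 0# B) λ (1≈0 , _) → nontrivial isPS-A (sym-A 1≈0)))
  where
    open Sig using (0#; 1#)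
    open IsWeakBetweennessAlgebra isWB using (ax5)
    open IsPSAlgebra using (nontrivial)
    open BooleanAlgebra (booleanAlgebra isPS-A) using () renaming (sym to sym-A)

two : Sig 0ℓ 0ℓ
two = record
  { Carrier = Bool ; _≈_ = _≡_ ; _+_ = _∨_ ; _·_ = _∧_ ; -_ = not
  ; 0# = false ; 1# = true ; f = _∧_ ; g = λ _ _ → true }

two-isPSAlgebra : IsPSAlgebra two
two-isPSAlgebra = record
  { isBooleanAlgebra = Bool.∨-∧-isBooleanAlgebra
  ; nontrivial = λ ()
  ; f-0ˡ = Bool.∧-zeroˡ
  ; f-0ʳ = Bool.∧-zeroʳ
  ; f-+ˡ = λ x x' y → Bool.∧-distribʳ-∨ y x x'
  ; f-+ʳ = Bool.∧-distribˡ-∨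
  ; g-0ˡ = λ _ → refl
  ; g-0ʳ = λ _ → refl
  ; g-+ˡ = λ _ _ _ → refl
  ; g-+ʳ = λ _ _ _ → refl
  }

two-isWeakBetweennessAlgebra : IsWeakBetweennessAlgebra two
two-isWeakBetweennessAlgebra = record
  { isPSAlgebra = two-isPSAlgebra
  ; ax1 = λ { false → refl ; true → refl }
  ; ax2 = λ { false _ → refl ; true false → refl ; true true → refl }
  ; ax3 = λ _ _ → refl
  ; ax4 = ax4
  ; ax5 = λ { false x≢0 → ⊥-elim (x≢0 refl) ; true _ → refl }
  }
  where
    ax4 : ∀ x y z → (y ∧ (x ∧ z)) ∧ ((x ∧ (x ∧ y)) ∧ z) ≡ y ∧ (x ∧ z)
    ax4 false false _ = refl
    ax4 false true  _ = refl
    ax4 true  false _ = refl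
    ax4 true  true  z = Bool.∧-idem z

proposition6p16 : Σ (Sig 0ℓ 0ℓ) λ A → Σ (Sig 0ℓ 0ℓ) λ B →
    IsWeakBetweennessAlgebra A × IsWeakBetweennessAlgebra B × ¬ IsWeakBetweennessAlgebra (A ⊗ B)
proposition6p16 =
  two , two , two-isWeakBetweennessAlgebra , two-isWeakBetweennessAlgebra ,
  ¬isWeakBetweenness-⊗ two-isPSAlgebra two-isPSAlgebra
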